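{- For all terms $t,s,t''$: if $t$ is reducible at the root position by $\to_{R_2,ACh}$ and $t''\approx_{AC}t+s$, then $t''$ is also reducible by $\to_{R_2,ACh}$.
   Context: Terms are over $\{+,h,0\}$, variables and free constants. $R_2$ is the rewrite system $x+x\to0$, $x+0\to x$, $x+(y+x)\to y$, $h(0)\to0$. $ACh$ is the theory generated by associativity and commutativity of $+$ and $h(x+y)\approx h(x)+h(y)$; $AC$ is associativity and commutativity of $+$. $t\to_{R_2,ACh}t'$ iff there are a non-variable position $p$ of $t$, a rule $l\to r\in R_2$ and a substitution $\sigma$ with $t|_p=_{ACh}l\sigma$ and $t'=t[r\sigma]_p$; reducibility at the root means this with $p$ the root position. -}

module Defs where

open import Data.Nat using (ℕ)
open import Data.Product using (Σ; ∃; _×_; _,_)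
open import Data.Empty using (⊥)
open import Data.Unit using (⊤)
open import Relation.Binary.PropositionalEquality using (_≡_)

infixl 6 _⊕_
data Term : Set where
  var  : ℕ → Term
  cst  : ℕ → Term
  𝟘    : Term
  _⊕_  : Term → Term → Term
  h    : Term → Term

Subst : Set
Subst = ℕ → Term

_⟨_⟩ : Term → Subst → Term
var x   ⟨ σ ⟩ = σ x
cst c   ⟨ σ ⟩ = cst c
𝟘       ⟨ σ ⟩ = 𝟘
(u ⊕ v) ⟨ σ ⟩ = (u ⟨ σ ⟩) ⊕ (v ⟨ σ ⟩)
h u     ⟨ σ ⟩ = h (u ⟨ σ ⟩)

IsVar : Term → Set
IsVar (var _) = ⊤
IsVar _       = ⊥

infix 4 _≈AC_
data _≈AC_ : Term → Term → Set where
  refl  : ∀ {t} → t ≈AC t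
  sym   : ∀ {t u} → t ≈AC u → u ≈AC t
  trans : ∀ {t u v} → t ≈AC u → u ≈AC v → t ≈AC v
  cong⊕ : ∀ {t t′ u u′} → t ≈AC t′ → u ≈AC u′ → t ⊕ u ≈AC t′ ⊕ u′
  congh : ∀ {t t′} → t ≈AC t′ → h t ≈AC h t′
  assoc : ∀ x y z → (x ⊕ y) ⊕ z ≈AC x ⊕ (y ⊕ z)
  comm  : ∀ x y → x ⊕ y ≈AC y ⊕ x

infix 4 _≈ACh_
data _≈ACh_ : Term → Term → Set where
  refl  : ∀ {t} → t ≈ACh t
  sym   : ∀ {t u} → t ≈ACh u → u ≈ACh t
  trans : ∀ {t u v} → t ≈ACh u → u ≈ACh v → t ≈ACh v
  cong⊕ : ∀ {t t′ u u′} → t ≈ACh t′ → u ≈ACh u′ → t ⊕ u ≈ACh t′ ⊕ u′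
  congh : ∀ {t t′} → t ≈ACh t′ → h t ≈ACh h t′
  assoc : ∀ x y z → (x ⊕ y) ⊕ z ≈ACh x ⊕ (y ⊕ z)
  comm  : ∀ x y → x ⊕ y ≈ACh y ⊕ x
  hdist : ∀ x y → h (x ⊕ y) ≈ACh h x ⊕ h y

-- The rewrite system R₂ (x = var 0, y = var 1).
data R₂ : Term → Term → Set where
  r-xx  : R₂ (var 0 ⊕ var 0) 𝟘
  r-x0  : R₂ (var 0 ⊕ 𝟘) (var 0)
  r-xyx : R₂ (var 0 ⊕ (var 1 ⊕ var 0)) (var 1)
  r-h0  : R₂ (h 𝟘) 𝟘

RootStep : Term → Term → Set
RootStep t t′ = Σ Term λ l → Σ Term λ r → Σ Subst λ σ →
  R₂ l r × (IsVar t → ⊥) × (t ≈ACh (l ⟨ σ ⟩)) × (t′ ≡ (r ⟨ σ ⟩))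

infix 4 _⟶_
data _⟶_ : Term → Term → Set where
  root : ∀ {t t′} → RootStep t t′ → t ⟶ t′
  ⊕ˡ   : ∀ {t t′ u} → t ⟶ t′ → t ⊕ u ⟶ t′ ⊕ u
  ⊕ʳ   : ∀ {t u u′} → u ⟶ u′ → t ⊕ u ⟶ t ⊕ u′
  hᶜ   : ∀ {t t′} → t ⟶ t′ → h t ⟶ h t′

ReducibleAtRoot : Term → Set
ReducibleAtRoot t = ∃ λ t′ → RootStep t t′

Reducible : Term → Set
Reducible t = ∃ λ t′ → t ⟶ t′

module Submission where

open import Defs
open import Data.Nat using (ℕ; zero; suc)
open import Data.Maybe using (Maybe; just; nothing)
import Data.Maybe as Maybe
open import Data.Product using (Σ; _×_; _,_)
open import Data.Sum using (_⊎_; inj₁; inj₂)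
open import Function using (_⇔_; Equivalence)
import Function.Properties.Equivalence as ⇔
open import Relation.Nullary using (¬_)
open import Relation.Binary.Bundles using (Setoid)
import Relation.Binary.Reasoning.Setoid
open import Relation.Binary.PropositionalEquality as P using (_≡_)

-- If the root redex t is an instance of one of the three sum rules, then
-- t + s is again an instance of a sum rule modulo AC, e.g. (u + u) + s ≈
-- u + (s + u) matches x + (y + x); being AC-equal to a sum, t'' is not a
-- variable, so it is reducible at the root.  Otherwise t ≈ACh h(0), and
-- h(0) is alone in its ACh-class; so h(0) occurs in t + s, occurrences of
-- h(0) survive AC rearrangement, and t'' contains the redex h(0).

≈AC⇒≈ACh : ∀ {t u} → t ≈AC u → t ≈ACh u
≈AC⇒≈ACh refl          = refl
≈AC⇒≈ACh (sym p)       = sym (≈AC⇒≈ACh p)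
≈AC⇒≈ACh (trans p q)   = trans (≈AC⇒≈ACh p) (≈AC⇒≈ACh q)
≈AC⇒≈ACh (cong⊕ p q)   = cong⊕ (≈AC⇒≈ACh p) (≈AC⇒≈ACh q)
≈AC⇒≈ACh (congh p)     = congh (≈AC⇒≈ACh p)
≈AC⇒≈ACh (assoc x y z) = assoc x y z
≈AC⇒≈ACh (comm x y)    = comm x y

≈ACh-setoid : Setoid _ _
≈ACh-setoid = record
  { Carrier       = Term
  ; _≈_           = _≈ACh_
  ; isEquivalence = record { refl = refl ; sym = sym ; trans = trans }
  }

IsVar-resp-≈ACh : ∀ {t u} → t ≈ACh u → IsVar t ⇔ IsVar u
IsVar-resp-≈ACh refl          = ⇔.refl
IsVar-resp-≈ACh (sym p)       = ⇔.sym (IsVar-resp-≈ACh p)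
IsVar-resp-≈ACh (trans p q)   = ⇔.trans (IsVar-resp-≈ACh p) (IsVar-resp-≈ACh q)
IsVar-resp-≈ACh (cong⊕ p q)   = ⇔.refl
IsVar-resp-≈ACh (congh p)     = ⇔.refl
IsVar-resp-≈ACh (assoc x y z) = ⇔.refl
IsVar-resp-≈ACh (comm x y)    = ⇔.refl
IsVar-resp-≈ACh (hdist x y)   = ⇔.refl

≈ACh-⊕⇒¬IsVar : ∀ {t u v} → t ≈ACh u ⊕ v → ¬ IsVar t
≈ACh-⊕⇒¬IsVar p = Equivalence.to (IsVar-resp-≈ACh p)

h^ : ℕ → Term
h^ zero    = 𝟘
h^ (suc n) = h (h^ n)

depth : Term → Maybe ℕ
depth 𝟘     = just 0
depth (h t) = Maybe.map suc (depth t)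
depth _     = nothing

depth-h^ : ∀ n → depth (h^ n) ≡ just n
depth-h^ zero    = P.refl
depth-h^ (suc n) = P.cong (Maybe.map suc) (depth-h^ n)

depth≡just⇒≡h^ : ∀ t {n} → depth t ≡ just n → t ≡ h^ n
depth≡just⇒≡h^ 𝟘 P.refl = P.refl
depth≡just⇒≡h^ (h t) eq with depth t in eqₜ
depth≡just⇒≡h^ (h t) P.refl | just m = P.cong h (depth≡just⇒≡h^ t eqₜ)

depth-resp-≈ACh : ∀ {t u} → t ≈ACh u → depth t ≡ depth u
depth-resp-≈ACh refl          = P.refl
depth-resp-≈ACh (sym p)       = P.sym (depth-resp-≈ACh p)
depth-resp-≈ACh (trans p q)   = P.trans (depth-resp-≈ACh p) (depth-resp-≈ACh q)
depth-resp-≈ACh (cong⊕ p q)   = P.refl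
depth-resp-≈ACh (congh p)     = P.cong (Maybe.map suc) (depth-resp-≈ACh p)
depth-resp-≈ACh (assoc x y z) = P.refl
depth-resp-≈ACh (comm x y)    = P.refl
depth-resp-≈ACh (hdist x y)   = P.refl

≈ACh-h^⇒≡h^ : ∀ {t} n → t ≈ACh h^ n → t ≡ h^ n
≈ACh-h^⇒≡h^ n p = depth≡just⇒≡h^ _ (P.trans (depth-resp-≈ACh p) (depth-h^ n))

infix 4 _⊑_
data _⊑_ : Term → Term → Set where
  here : ∀ {u}     → u ⊑ u
  ⊕ˡ   : ∀ {u a b} → u ⊑ a → u ⊑ a ⊕ b
  ⊕ʳ   : ∀ {u a b} → u ⊑ b → u ⊑ a ⊕ b
  hᶜ   : ∀ {u a}   → u ⊑ a → u ⊑ h a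

⊑-reducible : ∀ {u t} → u ⊑ t → Reducible u → Reducible t
⊑-reducible here   red         = red
⊑-reducible (⊕ˡ o) (_ , step) with ⊑-reducible o (_ , step)
... | _ , step′ = _ , ⊕ˡ step′
⊑-reducible (⊕ʳ o) (_ , step) with ⊑-reducible o (_ , step)
... | _ , step′ = _ , ⊕ʳ step′
⊑-reducible (hᶜ o) (_ , step) with ⊑-reducible o (_ , step)
... | _ , step′ = _ , hᶜ step′

module _ {w : Term} (rigid : ∀ {v} → v ≈AC w → v ≡ w) where

  h⊑-resp-≈AC : ∀ {t t′} → t ≈AC t′ → h w ⊑ t → h w ⊑ t′
  h⊑-resp-≈AC⁻ : ∀ {t t′} → t ≈AC t′ → h w ⊑ t′ → h w ⊑ t

  h⊑-resp-≈AC refl                 o               = o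
  h⊑-resp-≈AC (sym p)              o               = h⊑-resp-≈AC⁻ p o
  h⊑-resp-≈AC (trans p q)          o               = h⊑-resp-≈AC q (h⊑-resp-≈AC p o)
  h⊑-resp-≈AC (cong⊕ p q)          (⊕ˡ o)          = ⊕ˡ (h⊑-resp-≈AC p o)
  h⊑-resp-≈AC (cong⊕ p q)          (⊕ʳ o)          = ⊕ʳ (h⊑-resp-≈AC q o)
  h⊑-resp-≈AC (congh p)            here
    rewrite rigid (sym p)                          = here
  h⊑-resp-≈AC (congh p)            (hᶜ o)          = hᶜ (h⊑-resp-≈AC p o)
  h⊑-resp-≈AC (assoc x y z)        (⊕ˡ (⊕ˡ o))     = ⊕ˡ o
  h⊑-resp-≈AC (assoc x y z)        (⊕ˡ (⊕ʳ o))     = ⊕ʳ (⊕ˡ o)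
  h⊑-resp-≈AC (assoc x y z)        (⊕ʳ o)          = ⊕ʳ (⊕ʳ o)
  h⊑-resp-≈AC (comm x y)           (⊕ˡ o)          = ⊕ʳ o
  h⊑-resp-≈AC (comm x y)           (⊕ʳ o)          = ⊕ˡ o

  h⊑-resp-≈AC⁻ refl                o               = o
  h⊑-resp-≈AC⁻ (sym p)             o               = h⊑-resp-≈AC p o
  h⊑-resp-≈AC⁻ (trans p q)         o               = h⊑-resp-≈AC⁻ p (h⊑-resp-≈AC⁻ q o)
  h⊑-resp-≈AC⁻ (cong⊕ p q)         (⊕ˡ o)          = ⊕ˡ (h⊑-resp-≈AC⁻ p o)
  h⊑-resp-≈AC⁻ (cong⊕ p q)         (⊕ʳ o)          = ⊕ʳ (h⊑-resp-≈AC⁻ q o)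
  h⊑-resp-≈AC⁻ (congh p)           here
    rewrite rigid p                                = here
  h⊑-resp-≈AC⁻ (congh p)           (hᶜ o)          = hᶜ (h⊑-resp-≈AC⁻ p o)
  h⊑-resp-≈AC⁻ (assoc x y z)       (⊕ˡ o)          = ⊕ˡ (⊕ˡ o)
  h⊑-resp-≈AC⁻ (assoc x y z)       (⊕ʳ (⊕ˡ o))     = ⊕ˡ (⊕ʳ o)
  h⊑-resp-≈AC⁻ (assoc x y z)       (⊕ʳ (⊕ʳ o))     = ⊕ʳ o
  h⊑-resp-≈AC⁻ (comm x y)          (⊕ˡ o)          = ⊕ʳ o
  h⊑-resp-≈AC⁻ (comm x y)          (⊕ʳ o)          = ⊕ˡ o

h𝟘⊑-resp-≈AC⁻ : ∀ {t t′} → t ≈AC t′ → h 𝟘 ⊑ t′ → h 𝟘 ⊑ t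
h𝟘⊑-resp-≈AC⁻ = h⊑-resp-≈AC⁻ (λ p → ≈ACh-h^⇒≡h^ 0 (≈AC⇒≈ACh p))

LhsInstance : Term → Set
LhsInstance t = Σ Term λ l → Σ Term λ r → Σ Subst λ σ → R₂ l r × t ≈ACh l ⟨ σ ⟩

LhsInstance⇒Reducible : ∀ {t} → ¬ IsVar t → LhsInstance t → Reducible t
LhsInstance⇒Reducible ¬var (l , r , σ , rule , t≈lσ) =
  _ , root (l , r , σ , rule , ¬var , t≈lσ , P.refl)

LhsInstance-resp-≈ACh : ∀ {t u} → t ≈ACh u → LhsInstance u → LhsInstance t
LhsInstance-resp-≈ACh p (l , r , σ , rule , u≈lσ) = l , r , σ , rule , trans p u≈lσ

h𝟘-reducible : Reducible (h 𝟘)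
h𝟘-reducible = LhsInstance⇒Reducible (λ ()) (h 𝟘 , 𝟘 , var , r-h0 , refl)

pairSubst : Term → Term → Subst
pairSubst u v 0             = u
pairSubst u v 1             = v
pairSubst u v (suc (suc _)) = var 0

LhsInstance-⊕ : ∀ {t} s → ReducibleAtRoot t → LhsInstance (t ⊕ s) ⊎ t ≡ h 𝟘
LhsInstance-⊕ {t} s (_ , _ , _ , σ , r-xx , _ , t≈lσ , _) =
  inj₁ (_ , _ , pairSubst u s , r-xyx , (begin
    t ⊕ s         ≈⟨ cong⊕ t≈lσ refl ⟩
    (u ⊕ u) ⊕ s   ≈⟨ assoc u u s ⟩
    u ⊕ (u ⊕ s)   ≈⟨ cong⊕ refl (comm u s) ⟩
    u ⊕ (s ⊕ u)   ∎))
  where open Relation.Binary.Reasoning.Setoid ≈ACh-setoid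
        u = σ 0
LhsInstance-⊕ {t} s (_ , _ , _ , σ , r-x0 , _ , t≈lσ , _) =
  inj₁ (_ , _ , pairSubst (u ⊕ s) s , r-x0 , (begin
    t ⊕ s         ≈⟨ cong⊕ t≈lσ refl ⟩
    (u ⊕ 𝟘) ⊕ s   ≈⟨ assoc u 𝟘 s ⟩
    u ⊕ (𝟘 ⊕ s)   ≈⟨ cong⊕ refl (comm 𝟘 s) ⟩
    u ⊕ (s ⊕ 𝟘)   ≈⟨ sym (assoc u s 𝟘) ⟩
    (u ⊕ s) ⊕ 𝟘   ∎))
  where open Relation.Binary.Reasoning.Setoid ≈ACh-setoid
        u = σ 0
LhsInstance-⊕ {t} s (_ , _ , _ , σ , r-xyx , _ , t≈lσ , _) =
  inj₁ (_ , _ , pairSubst u (v ⊕ s) , r-xyx , (begin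
    t ⊕ s               ≈⟨ cong⊕ t≈lσ refl ⟩
    (u ⊕ (v ⊕ u)) ⊕ s   ≈⟨ assoc u (v ⊕ u) s ⟩
    u ⊕ ((v ⊕ u) ⊕ s)   ≈⟨ cong⊕ refl (assoc v u s) ⟩
    u ⊕ (v ⊕ (u ⊕ s))   ≈⟨ cong⊕ refl (cong⊕ refl (comm u s)) ⟩
    u ⊕ (v ⊕ (s ⊕ u))   ≈⟨ cong⊕ refl (sym (assoc v s u)) ⟩
    u ⊕ ((v ⊕ s) ⊕ u)   ∎))
  where open Relation.Binary.Reasoning.Setoid ≈ACh-setoid
        u = σ 0
        v = σ 1
LhsInstance-⊕ s (_ , _ , _ , σ , r-h0 , _ , t≈h𝟘 , _) = inj₂ (≈ACh-h^⇒≡h^ 1 t≈h𝟘)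

mainTheorem14 : ∀ (t s t″ : Term) → ReducibleAtRoot t → t″ ≈AC t ⊕ s → Reducible t″
mainTheorem14 t s t″ red t″≈t⊕s with LhsInstance-⊕ s red
... | inj₁ t⊕s-instance =
  LhsInstance⇒Reducible (≈ACh-⊕⇒¬IsVar t″≈ACht⊕s)
                        (LhsInstance-resp-≈ACh t″≈ACht⊕s t⊕s-instance)
  where t″≈ACht⊕s = ≈AC⇒≈ACh t″≈t⊕s
... | inj₂ P.refl = ⊑-reducible (h𝟘⊑-resp-≈AC⁻ t″≈t⊕s (⊕ˡ here)) h𝟘-reducible
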